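{- Let $\mathbb{F}$ be a field of characteristic $p > 0$, let $t \geq 1$ and $\ell \geq 0$ be integers, and let $d, b \geq 0$ be integers with $d < \frac{p}{t}$ and $b < p$. Suppose $f(X), A(X), B(X) \in \mathbb{F}[X]$ satisfy $$f(X)^t = A(X)\cdot X^{\ell} + B(X),$$ where $\deg f \leq d$, $\deg B \leq b$, $A(X) \neq 0$ and $B(X) \neq 0$. Then $d + b \geq \ell$. -}

module Defs where

open import Level using (Level)
open import Data.Nat as ℕ using (ℕ; zero; suc)
open import Data.List using (List; []; _∷_; map; replicate; _++_)
open import Data.Product using (∃; _×_)
open import Relation.Nullary using (¬_)
open import Algebra.Bundles using (CommutativeRing)

record IsField {c ℓ : Level} (R : CommutativeRing c ℓ) : Set (Level._⊔_ c ℓ) where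
  open CommutativeRing R
  field
    1≉0     : ¬ (1# ≈ 0#)
    inverse : ∀ x → ¬ (x ≈ 0#) → ∃ λ y → (x * y) ≈ 1#

module Poly {c ℓ : Level} (R : CommutativeRing c ℓ) where
  open CommutativeRing R

  natCast : ℕ → Carrier
  natCast zero    = 0#
  natCast (suc n) = 1# + natCast n

  HasCharacteristic : ℕ → Set ℓ
  HasCharacteristic p =
    (0 ℕ.< p) × (natCast p ≈ 0#) × (∀ k → 0 ℕ.< k → k ℕ.< p → ¬ (natCast k ≈ 0#))

  -- polynomials in R[X] as coefficient lists, constant coefficient first
  -- (trailing zeros allowed; equality is coefficientwise)
  Pol : Set c
  Pol = List Carrier

  coeff : Pol → ℕ → Carrier
  coeff []      _       = 0#
  coeff (a ∷ _) zero    = a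
  coeff (_ ∷ f) (suc n) = coeff f n

  infixl 6 _+ₚ_
  _+ₚ_ : Pol → Pol → Pol
  []      +ₚ g       = g
  (a ∷ f) +ₚ []      = a ∷ f
  (a ∷ f) +ₚ (b ∷ g) = (a + b) ∷ (f +ₚ g)

  infixl 7 _*ₚ_
  _*ₚ_ : Pol → Pol → Pol
  []      *ₚ g = []
  (a ∷ f) *ₚ g = map (a *_) g +ₚ (0# ∷ (f *ₚ g))

  oneₚ : Pol
  oneₚ = 1# ∷ []

  infixr 8 _^ₚ_
  _^ₚ_ : Pol → ℕ → Pol
  f ^ₚ zero  = oneₚ
  f ^ₚ suc t = f *ₚ (f ^ₚ t)

  Xpow : ℕ → Pol
  Xpow n = replicate n 0# ++ (1# ∷ [])

  _≈ₚ_ : Pol → Pol → Set ℓ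
  f ≈ₚ g = ∀ n → coeff f n ≈ coeff g n

  NonZeroₚ : Pol → Set ℓ
  NonZeroₚ f = ∃ λ n → ¬ (coeff f n ≈ 0#)

  -- deg f ≤ d  (the zero polynomial has degree ≤ d for every d)
  DegLe : Pol → ℕ → Set ℓ
  DegLe f d = ∀ n → d ℕ.< n → coeff f n ≈ 0#

-- Suppose ℓ > d + b and put g = f^t. Let m be the order of f. Comparing the coefficients of
-- X^(m+n) in the Euler identity f·θ(f^t) = t·θf·f^t (θ = X·d/dX) gives
--   (n − tm)·f_m·g_n = a combination of g_(n−1), …, g_(n−(d−m)),
-- and n − tm is invertible in 𝔽 whenever n ≠ tm and n, tm < p.
-- If tm > b, then g vanishes below tm, hence so does B, which agrees with g below X^ℓ; so B = 0.
-- If tm ≤ b, then g vanishes on (b, ℓ), a window longer than d, and the recurrence carries these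
-- zeros to every n > b (beyond td they vanish for degree reasons), so A = 0.

module Submission where

open import Level using (Level)
open import Algebra.Bundles using (CommutativeRing)
open import Data.Nat using (ℕ; zero; suc; _∸_; _<_; _≤_; z≤n; s≤s; _≤?_; _<?_)
import Data.Nat as ℕ
import Data.Nat.Properties as ℕₚ
open import Data.Nat.Induction using (<-rec)
open import Data.List using ([]; _∷_; map)
open import Data.Product using (_,_; proj₂)
open import Data.Sum using (_⊎_; inj₁; inj₂)
open import Function using (_∘_)
open import Relation.Nullary using (¬_; yes; no; contradiction)
open import Relation.Binary.Definitions using (tri<; tri≈; tri>)
open import Relation.Binary.Bundles using (Setoid)
open import Relation.Binary.Structures using (IsEquivalence)
open import Relation.Binary.PropositionalEquality using (_≡_; _≢_)
import Relation.Binary.PropositionalEquality as ≡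
open import Defs

n<m+k⇒n∸i<k : ∀ {m i n k} → m ≤ i → i ≤ n → n < m ℕ.+ k → n ∸ i < k
n<m+k⇒n∸i<k {m} {i} {n} {k} m≤i i≤n n<m+k = ℕₚ.≤-<-trans (ℕₚ.∸-monoʳ-≤ n m≤i) n∸m<k
  where
  n∸m<k : n ∸ m < k
  n∸m<k = ℕₚ.≤-trans (ℕₚ.≤-reflexive (≡.sym (ℕₚ.+-∸-assoc 1 (ℕₚ.≤-trans m≤i i≤n))))
                     (ℕₚ.m≤n+o⇒m∸n≤o (suc n) m n<m+k)

d+e<n⇒e<n∸i : ∀ {i d e n} → i ≤ d → d ℕ.+ e < n → e < n ∸ i
d+e<n⇒e<n∸i {i} {d} {e} {n} i≤d d+e<n = ℕₚ.m+n≤o⇒m≤o∸n (suc e) (ℕₚ.≤-trans (s≤s e+i≤d+e) d+e<n)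
  where
  e+i≤d+e : e ℕ.+ i ≤ d ℕ.+ e
  e+i≤d+e = ℕₚ.≤-trans (ℕₚ.+-monoʳ-≤ e i≤d) (ℕₚ.≤-reflexive (ℕₚ.+-comm e d))

module PolynomialArithmetic {c ℓ : Level} (R : CommutativeRing c ℓ) where
  open CommutativeRing R
  open Poly R
  open import Algebra.Solver.Ring.NaturalCoefficients.Default commutativeSemiring
    using (solve; _:+_; _:*_; _:=_)
  open import Relation.Binary.Reasoning.Setoid setoid

  infixr 7 _·ₚ_
  _·ₚ_ : Carrier → Pol → Pol
  a ·ₚ g = map (a *_) g

  coeff-+ₚ : ∀ f g n → coeff (f +ₚ g) n ≈ coeff f n + coeff g n
  coeff-+ₚ []      g       n       = sym (+-identityˡ _)
  coeff-+ₚ (a ∷ f) []      n       = sym (+-identityʳ _)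
  coeff-+ₚ (a ∷ f) (b ∷ g) zero    = refl
  coeff-+ₚ (a ∷ f) (b ∷ g) (suc n) = coeff-+ₚ f g n

  coeff-·ₚ : ∀ a g n → coeff (a ·ₚ g) n ≈ a * coeff g n
  coeff-·ₚ a []      n       = sym (zeroʳ a)
  coeff-·ₚ a (b ∷ g) zero    = refl
  coeff-·ₚ a (b ∷ g) (suc n) = coeff-·ₚ a g n

  coeff-∷-*ₚ : ∀ a f g n → coeff ((a ∷ f) *ₚ g) n ≈ a * coeff g n + coeff (0# ∷ f *ₚ g) n
  coeff-∷-*ₚ a f g n = trans (coeff-+ₚ (a ·ₚ g) (0# ∷ f *ₚ g) n) (+-congʳ (coeff-·ₚ a g n))

  coeff-0∷-+ₚ : ∀ f g n → coeff (0# ∷ f +ₚ g) n ≈ coeff (0# ∷ f) n + coeff (0# ∷ g) n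
  coeff-0∷-+ₚ f g zero    = sym (+-identityˡ 0#)
  coeff-0∷-+ₚ f g (suc n) = coeff-+ₚ f g n

  -- _≈ₚ_ wrapped in a record, so that both polynomials can be inferred from a proof.
  infix 4 _≋_
  record _≋_ (f g : Pol) : Set ℓ where
    constructor coeffwise
    field at : f ≈ₚ g
  open _≋_ public

  ≋-isEquivalence : IsEquivalence _≋_
  ≋-isEquivalence = record
    { refl  = coeffwise λ n → refl
    ; sym   = λ p → coeffwise λ n → sym (at p n)
    ; trans = λ p q → coeffwise λ n → trans (at p n) (at q n)
    }

  ≋-setoid : Setoid c ℓ
  ≋-setoid = record { isEquivalence = ≋-isEquivalence }

  open IsEquivalence ≋-isEquivalence public
    using () renaming (refl to ≋-refl; sym to ≋-sym; trans to ≋-trans)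

  ∷-cong : ∀ {a b f g} → a ≈ b → f ≋ g → a ∷ f ≋ b ∷ g
  ∷-cong a≈b f≋g = coeffwise λ { zero → a≈b ; (suc n) → at f≋g n }

  +ₚ-cong : ∀ {f f′ g g′} → f ≋ f′ → g ≋ g′ → f +ₚ g ≋ f′ +ₚ g′
  +ₚ-cong {f} {f′} {g} {g′} f≋f′ g≋g′ = coeffwise λ n → begin
    coeff (f +ₚ g) n         ≈⟨ coeff-+ₚ f g n ⟩
    coeff f n + coeff g n    ≈⟨ +-cong (at f≋f′ n) (at g≋g′ n) ⟩
    coeff f′ n + coeff g′ n  ≈⟨ coeff-+ₚ f′ g′ n ⟨
    coeff (f′ +ₚ g′) n       ∎

  ·ₚ-congˡ : ∀ a {g g′} → g ≋ g′ → a ·ₚ g ≋ a ·ₚ g′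
  ·ₚ-congˡ a {g} {g′} g≋g′ = coeffwise λ n → begin
    coeff (a ·ₚ g) n   ≈⟨ coeff-·ₚ a g n ⟩
    a * coeff g n      ≈⟨ *-congˡ (at g≋g′ n) ⟩
    a * coeff g′ n     ≈⟨ coeff-·ₚ a g′ n ⟨
    coeff (a ·ₚ g′) n  ∎

  *ₚ-congˡ : ∀ f {g g′} → g ≋ g′ → f *ₚ g ≋ f *ₚ g′
  *ₚ-congˡ []      g≋g′ = ≋-refl
  *ₚ-congˡ (a ∷ f) g≋g′ = +ₚ-cong (·ₚ-congˡ a g≋g′) (∷-cong refl (*ₚ-congˡ f g≋g′))

  +ₚ-identityʳ : ∀ f → f +ₚ [] ≋ f
  +ₚ-identityʳ f = coeffwise λ n → trans (coeff-+ₚ f [] n) (+-identityʳ _)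

  ·ₚ-zeroˡ : ∀ g → 0# ·ₚ g ≋ []
  ·ₚ-zeroˡ g = coeffwise λ n → trans (coeff-·ₚ 0# g n) (zeroˡ _)

  ·ₚ-identityˡ : ∀ g → 1# ·ₚ g ≋ g
  ·ₚ-identityˡ g = coeffwise λ n → trans (coeff-·ₚ 1# g n) (*-identityˡ _)

  ·ₚ-distribʳ-+ : ∀ a b g → (a + b) ·ₚ g ≋ a ·ₚ g +ₚ b ·ₚ g
  ·ₚ-distribʳ-+ a b g = coeffwise λ n → begin
    coeff ((a + b) ·ₚ g) n               ≈⟨ coeff-·ₚ (a + b) g n ⟩
    (a + b) * coeff g n                  ≈⟨ distribʳ _ a b ⟩
    a * coeff g n + b * coeff g n        ≈⟨ +-cong (coeff-·ₚ a g n) (coeff-·ₚ b g n) ⟨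
    coeff (a ·ₚ g) n + coeff (b ·ₚ g) n  ≈⟨ coeff-+ₚ (a ·ₚ g) (b ·ₚ g) n ⟨
    coeff (a ·ₚ g +ₚ b ·ₚ g) n           ∎

  *ₚ-identityˡ : ∀ g → oneₚ *ₚ g ≋ g
  *ₚ-identityˡ g = coeffwise λ n → begin
    coeff (oneₚ *ₚ g) n                 ≈⟨ coeff-∷-*ₚ 1# [] g n ⟩
    1# * coeff g n + coeff (0# ∷ []) n  ≈⟨ +-cong (*-identityˡ _) (0∷[]≈0 n) ⟩
    coeff g n + 0#                      ≈⟨ +-identityʳ _ ⟩
    coeff g n                           ∎
    where
    0∷[]≈0 : ∀ n → coeff (0# ∷ []) n ≈ 0#
    0∷[]≈0 zero    = refl
    0∷[]≈0 (suc n) = refl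

  *ₚ-zeroʳ : ∀ f → f *ₚ [] ≋ []
  *ₚ-zeroʳ []      = ≋-refl
  *ₚ-zeroʳ (a ∷ f) = coeffwise λ { zero → refl ; (suc n) → at (*ₚ-zeroʳ f) n }

  0∷-*ₚ : ∀ f g → (0# ∷ f) *ₚ g ≋ 0# ∷ f *ₚ g
  0∷-*ₚ f g = coeffwise λ n → begin
    coeff ((0# ∷ f) *ₚ g) n                 ≈⟨ coeff-∷-*ₚ 0# f g n ⟩
    0# * coeff g n + coeff (0# ∷ f *ₚ g) n  ≈⟨ +-congʳ (zeroˡ _) ⟩
    0# + coeff (0# ∷ f *ₚ g) n              ≈⟨ +-identityˡ _ ⟩
    coeff (0# ∷ f *ₚ g) n                   ∎

  *ₚ-∷ʳ : ∀ f b g → f *ₚ (b ∷ g) ≋ (b ·ₚ f) +ₚ (0# ∷ f *ₚ g)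
  *ₚ-∷ʳ f b g = coeffwise (go f)
    where
    go : ∀ f n → coeff (f *ₚ (b ∷ g)) n ≈ coeff ((b ·ₚ f) +ₚ (0# ∷ f *ₚ g)) n
    go []      zero    = refl
    go []      (suc n) = refl
    go (a ∷ f) zero    = +-congʳ (*-comm a b)
    go (a ∷ f) (suc n) = begin
      coeff ((a ·ₚ g) +ₚ f *ₚ (b ∷ g)) n
        ≈⟨ coeff-+ₚ (a ·ₚ g) (f *ₚ (b ∷ g)) n ⟩
      coeff (a ·ₚ g) n + coeff (f *ₚ (b ∷ g)) n
        ≈⟨ +-cong (coeff-·ₚ a g n) (trans (go f n) (coeff-+ₚ (b ·ₚ f) (0# ∷ f *ₚ g) n)) ⟩
      a * coeff g n + (coeff (b ·ₚ f) n + coeff (0# ∷ f *ₚ g) n)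
        ≈⟨ x+[y+z]≈y+[x+z] _ _ _ ⟩
      coeff (b ·ₚ f) n + (a * coeff g n + coeff (0# ∷ f *ₚ g) n)
        ≈⟨ +-congˡ (coeff-∷-*ₚ a f g n) ⟨
      coeff (b ·ₚ f) n + coeff ((a ∷ f) *ₚ g) n
        ≈⟨ coeff-+ₚ (b ·ₚ f) ((a ∷ f) *ₚ g) n ⟨
      coeff ((b ·ₚ f) +ₚ (a ∷ f) *ₚ g) n
        ∎
      where
      x+[y+z]≈y+[x+z] : ∀ x y z → x + (y + z) ≈ y + (x + z)
      x+[y+z]≈y+[x+z] = solve 3 (λ x y z → x :+ (y :+ z) := y :+ (x :+ z)) refl

  *ₚ-comm : ∀ f g → f *ₚ g ≋ g *ₚ f
  *ₚ-comm []      g = ≋-sym (*ₚ-zeroʳ g)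
  *ₚ-comm (a ∷ f) g = ≋-trans (+ₚ-cong ≋-refl (∷-cong refl (*ₚ-comm f g))) (≋-sym (*ₚ-∷ʳ g a f))

  *ₚ-congʳ : ∀ {f f′} g → f ≋ f′ → f *ₚ g ≋ f′ *ₚ g
  *ₚ-congʳ {f} {f′} g f≋f′ = ≋-trans (*ₚ-comm f g) (≋-trans (*ₚ-congˡ g f≋f′) (*ₚ-comm g f′))

  *ₚ-distribʳ-+ₚ : ∀ f g h → (f +ₚ g) *ₚ h ≋ f *ₚ h +ₚ g *ₚ h
  *ₚ-distribʳ-+ₚ []      g       h = ≋-refl
  *ₚ-distribʳ-+ₚ (a ∷ f) []      h = ≋-sym (+ₚ-identityʳ _)
  *ₚ-distribʳ-+ₚ (a ∷ f) (b ∷ g) h = coeffwise λ n → begin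
    coeff (((a + b) ∷ f +ₚ g) *ₚ h) n
      ≈⟨ coeff-∷-*ₚ (a + b) (f +ₚ g) h n ⟩
    (a + b) * coeff h n + coeff (0# ∷ (f +ₚ g) *ₚ h) n
      ≈⟨ +-congˡ (at (∷-cong refl (*ₚ-distribʳ-+ₚ f g h)) n) ⟩
    (a + b) * coeff h n + coeff (0# ∷ f *ₚ h +ₚ g *ₚ h) n
      ≈⟨ +-congˡ (coeff-0∷-+ₚ (f *ₚ h) (g *ₚ h) n) ⟩
    (a + b) * coeff h n + (coeff (0# ∷ f *ₚ h) n + coeff (0# ∷ g *ₚ h) n)
      ≈⟨ rearrange a b _ _ _ ⟩
    (a * coeff h n + coeff (0# ∷ f *ₚ h) n) + (b * coeff h n + coeff (0# ∷ g *ₚ h) n)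
      ≈⟨ +-cong (coeff-∷-*ₚ a f h n) (coeff-∷-*ₚ b g h n) ⟨
    coeff ((a ∷ f) *ₚ h) n + coeff ((b ∷ g) *ₚ h) n
      ≈⟨ coeff-+ₚ ((a ∷ f) *ₚ h) ((b ∷ g) *ₚ h) n ⟨
    coeff ((a ∷ f) *ₚ h +ₚ (b ∷ g) *ₚ h) n
      ∎
    where
    rearrange : ∀ a b x y z → (a + b) * x + (y + z) ≈ (a * x + y) + (b * x + z)
    rearrange = solve 5 (λ a b x y z → (a :+ b) :* x :+ (y :+ z) := (a :* x :+ y) :+ (b :* x :+ z)) refl

  *ₚ-distribˡ-+ₚ : ∀ f g h → f *ₚ (g +ₚ h) ≋ f *ₚ g +ₚ f *ₚ h
  *ₚ-distribˡ-+ₚ f g h =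
    ≋-trans (*ₚ-comm f (g +ₚ h))
      (≋-trans (*ₚ-distribʳ-+ₚ g h f) (+ₚ-cong (*ₚ-comm g f) (*ₚ-comm h f)))

  ·ₚ-*ₚ-assoc : ∀ a g h → (a ·ₚ g) *ₚ h ≋ a ·ₚ (g *ₚ h)
  ·ₚ-*ₚ-assoc a []      h = ≋-refl
  ·ₚ-*ₚ-assoc a (b ∷ g) h = coeffwise λ n → begin
    coeff ((a * b ∷ a ·ₚ g) *ₚ h) n
      ≈⟨ coeff-∷-*ₚ (a * b) (a ·ₚ g) h n ⟩
    a * b * coeff h n + coeff (0# ∷ (a ·ₚ g) *ₚ h) n
      ≈⟨ +-congˡ (at (∷-cong refl (·ₚ-*ₚ-assoc a g h)) n) ⟩
    a * b * coeff h n + coeff (0# ∷ a ·ₚ (g *ₚ h)) n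
      ≈⟨ +-congˡ (at (∷-cong (sym (zeroʳ a)) ≋-refl) n) ⟩
    a * b * coeff h n + coeff (a ·ₚ (0# ∷ g *ₚ h)) n
      ≈⟨ +-congˡ (coeff-·ₚ a (0# ∷ g *ₚ h) n) ⟩
    a * b * coeff h n + a * coeff (0# ∷ g *ₚ h) n
      ≈⟨ factor a b _ _ ⟩
    a * (b * coeff h n + coeff (0# ∷ g *ₚ h) n)
      ≈⟨ *-congˡ (coeff-∷-*ₚ b g h n) ⟨
    a * coeff ((b ∷ g) *ₚ h) n
      ≈⟨ coeff-·ₚ a ((b ∷ g) *ₚ h) n ⟨
    coeff (a ·ₚ ((b ∷ g) *ₚ h)) n
      ∎
    where
    factor : ∀ a b x y → a * b * x + a * y ≈ a * (b * x + y)
    factor = solve 4 (λ a b x y → a :* b :* x :+ a :* y := a :* (b :* x :+ y)) refl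

  *ₚ-assoc : ∀ f g h → (f *ₚ g) *ₚ h ≋ f *ₚ (g *ₚ h)
  *ₚ-assoc []      g h = ≋-refl
  *ₚ-assoc (a ∷ f) g h =
    ≋-trans (*ₚ-distribʳ-+ₚ (a ·ₚ g) (0# ∷ f *ₚ g) h)
      (+ₚ-cong (·ₚ-*ₚ-assoc a g h) (≋-trans (0∷-*ₚ (f *ₚ g) h) (∷-cong refl (*ₚ-assoc f g h))))

  *ₚ-·ₚ-comm : ∀ f a h → f *ₚ (a ·ₚ h) ≋ a ·ₚ (f *ₚ h)
  *ₚ-·ₚ-comm f a h =
    ≋-trans (*ₚ-comm f (a ·ₚ h)) (≋-trans (·ₚ-*ₚ-assoc a h f) (·ₚ-congˡ a (*ₚ-comm h f)))

  *ₚ-leftComm : ∀ f g h → f *ₚ (g *ₚ h) ≋ g *ₚ (f *ₚ h)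
  *ₚ-leftComm f g h =
    ≋-trans (≋-sym (*ₚ-assoc f g h)) (≋-trans (*ₚ-congʳ h (*ₚ-comm f g)) (*ₚ-assoc g f h))

module PolynomialCoefficients {c ℓ : Level} (R : CommutativeRing c ℓ) where
  open CommutativeRing R
  open Poly R
  open PolynomialArithmetic R
  open import Algebra.Solver.Ring.NaturalCoefficients.Default commutativeSemiring
    using (solve; _:*_; _:=_)
  open import Relation.Binary.Reasoning.Setoid setoid

  x≈0⊎y≈0⇒x*y≈0 : ∀ {x y} → x ≈ 0# ⊎ y ≈ 0# → x * y ≈ 0#
  x≈0⊎y≈0⇒x*y≈0 (inj₁ x≈0) = trans (*-congʳ x≈0) (zeroˡ _)
  x≈0⊎y≈0⇒x*y≈0 (inj₂ y≈0) = trans (*-congˡ y≈0) (zeroʳ _)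

  eulerFrom : ℕ → Pol → Pol
  eulerFrom k []      = []
  eulerFrom k (a ∷ f) = natCast k * a ∷ eulerFrom (suc k) f

  euler : Pol → Pol
  euler = eulerFrom 0

  coeff-eulerFrom : ∀ k f n → coeff (eulerFrom k f) n ≈ natCast (k ℕ.+ n) * coeff f n
  coeff-eulerFrom k []      n       = sym (zeroʳ _)
  coeff-eulerFrom k (a ∷ f) zero    = *-congʳ (reflexive (≡.cong natCast (≡.sym (ℕₚ.+-identityʳ k))))
  coeff-eulerFrom k (a ∷ f) (suc n) =
    trans (coeff-eulerFrom (suc k) f n) (*-congʳ (reflexive (≡.cong natCast (≡.sym (ℕₚ.+-suc k n)))))

  coeff-euler : ∀ f n → coeff (euler f) n ≈ natCast n * coeff f n
  coeff-euler = coeff-eulerFrom 0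

  coeff-euler-vanishes : ∀ f {n} → coeff f n ≈ 0# → coeff (euler f) n ≈ 0#
  coeff-euler-vanishes f {n} fn≈0 = trans (coeff-euler f n) (x≈0⊎y≈0⇒x*y≈0 (inj₂ fn≈0))

  euler-+ₚ : ∀ f g → euler (f +ₚ g) ≋ euler f +ₚ euler g
  euler-+ₚ f g = coeffwise λ n → begin
    coeff (euler (f +ₚ g)) n                       ≈⟨ coeff-euler (f +ₚ g) n ⟩
    natCast n * coeff (f +ₚ g) n                   ≈⟨ *-congˡ (coeff-+ₚ f g n) ⟩
    natCast n * (coeff f n + coeff g n)            ≈⟨ distribˡ _ _ _ ⟩
    natCast n * coeff f n + natCast n * coeff g n  ≈⟨ +-cong (coeff-euler f n) (coeff-euler g n) ⟨
    coeff (euler f) n + coeff (euler g) n          ≈⟨ coeff-+ₚ (euler f) (euler g) n ⟨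
    coeff (euler f +ₚ euler g) n                   ∎

  euler-·ₚ : ∀ a g → euler (a ·ₚ g) ≋ a ·ₚ euler g
  euler-·ₚ a g = coeffwise λ n → begin
    coeff (euler (a ·ₚ g)) n      ≈⟨ coeff-euler (a ·ₚ g) n ⟩
    natCast n * coeff (a ·ₚ g) n  ≈⟨ *-congˡ (coeff-·ₚ a g n) ⟩
    natCast n * (a * coeff g n)   ≈⟨ x*[y*z]≈y*[x*z] _ _ _ ⟩
    a * (natCast n * coeff g n)   ≈⟨ *-congˡ (coeff-euler g n) ⟨
    a * coeff (euler g) n         ≈⟨ coeff-·ₚ a (euler g) n ⟨
    coeff (a ·ₚ euler g) n        ∎
    where
    x*[y*z]≈y*[x*z] : ∀ x y z → x * (y * z) ≈ y * (x * z)
    x*[y*z]≈y*[x*z] = solve 3 (λ x y z → x :* (y :* z) := y :* (x :* z)) refl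

  euler-∷ : ∀ a f → euler (a ∷ f) ≋ 0# ∷ euler f +ₚ f
  euler-∷ a f = coeffwise λ
    { zero    → zeroˡ a
    ; (suc n) → begin
        coeff (euler (a ∷ f)) (suc n)           ≈⟨ coeff-euler (a ∷ f) (suc n) ⟩
        natCast (suc n) * coeff f n             ≈⟨ distribʳ _ 1# (natCast n) ⟩
        1# * coeff f n + natCast n * coeff f n  ≈⟨ +-comm _ _ ⟩
        natCast n * coeff f n + 1# * coeff f n  ≈⟨ +-cong (coeff-euler f n) (sym (*-identityˡ _)) ⟨
        coeff (euler f) n + coeff f n           ≈⟨ coeff-+ₚ (euler f) f n ⟨
        coeff (euler f +ₚ f) n                  ∎
    }

  conv : (ℕ → Carrier) → (ℕ → Carrier) → ℕ → Carrier
  conv a b zero    = a 0 * b 0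
  conv a b (suc n) = a 0 * b (suc n) + conv (a ∘ suc) b n

  conv-vanishes : ∀ a b n → (∀ i → i ≤ n → a i ≈ 0# ⊎ b (n ∸ i) ≈ 0#) → conv a b n ≈ 0#
  conv-vanishes a b zero    h = x≈0⊎y≈0⇒x*y≈0 (h 0 z≤n)
  conv-vanishes a b (suc n) h = trans
    (+-cong (x≈0⊎y≈0⇒x*y≈0 (h 0 z≤n)) (conv-vanishes (a ∘ suc) b n λ i i≤n → h (suc i) (s≤s i≤n)))
    (+-identityʳ 0#)

  conv-head : ∀ a b n → (∀ i → 0 < i → i ≤ n → a i ≈ 0# ⊎ b (n ∸ i) ≈ 0#) → conv a b n ≈ a 0 * b n
  conv-head a b zero    h = refl
  conv-head a b (suc n) h = trans
    (+-congˡ (conv-vanishes (a ∘ suc) b n λ i i≤n → h (suc i) (s≤s z≤n) (s≤s i≤n)))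
    (+-identityʳ _)

  conv-shift : ∀ m a b n → (∀ i → i < m → a i ≈ 0#) → conv a b (m ℕ.+ n) ≈ conv (λ i → a (m ℕ.+ i)) b n
  conv-shift zero    a b n h = refl
  conv-shift (suc m) a b n h = trans
    (+-cong (x≈0⊎y≈0⇒x*y≈0 (inj₁ (h 0 (s≤s z≤n)))) (conv-shift m (a ∘ suc) b n λ i i<m → h (suc i) (s≤s i<m)))
    (+-identityˡ _)

  coeff-*ₚ : ∀ f g n → coeff (f *ₚ g) n ≈ conv (coeff f) (coeff g) n
  coeff-*ₚ []      g n       = sym (conv-vanishes (coeff []) (coeff g) n λ i _ → inj₁ refl)
  coeff-*ₚ (a ∷ f) g zero    = trans (coeff-∷-*ₚ a f g 0) (+-identityʳ _)
  coeff-*ₚ (a ∷ f) g (suc n) = trans (coeff-∷-*ₚ a f g (suc n)) (+-congˡ (coeff-*ₚ f g n))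

  VanishesBelow : Pol → ℕ → Set ℓ
  VanishesBelow f m = ∀ i → i < m → coeff f i ≈ 0#

  VanishesBelow-suc : ∀ f {m} → VanishesBelow f m → coeff f m ≈ 0# → VanishesBelow f (suc m)
  VanishesBelow-suc f f<m fm≈0 i i<1+m with ℕₚ.m<1+n⇒m<n∨m≡n i<1+m
  ... | inj₁ i<m    = f<m i i<m
  ... | inj₂ ≡.refl = fm≈0

  NonZeroₚ⇒≉[] : ∀ {f} → NonZeroₚ f → ¬ f ≋ []
  NonZeroₚ⇒≉[] (n , fn≉0) f≋[] = fn≉0 (at f≋[] n)

  coeff-*ₚ-lowest : ∀ f g m n → VanishesBelow f m →
                    (∀ i → 0 < i → i ≤ n → coeff f (m ℕ.+ i) ≈ 0# ⊎ coeff g (n ∸ i) ≈ 0#) →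
                    coeff (f *ₚ g) (m ℕ.+ n) ≈ coeff f m * coeff g n
  coeff-*ₚ-lowest f g m n f<m h = begin
    coeff (f *ₚ g) (m ℕ.+ n)                    ≈⟨ coeff-*ₚ f g (m ℕ.+ n) ⟩
    conv (coeff f) (coeff g) (m ℕ.+ n)          ≈⟨ conv-shift m (coeff f) (coeff g) n f<m ⟩
    conv (λ i → coeff f (m ℕ.+ i)) (coeff g) n  ≈⟨ conv-head _ (coeff g) n h ⟩
    coeff f (m ℕ.+ 0) * coeff g n               ≡⟨ ≡.cong (λ k → coeff f k * coeff g n) (ℕₚ.+-identityʳ m) ⟩
    coeff f m * coeff g n                       ∎

  DegLe-*ₚ : ∀ f g {d e} → DegLe f d → DegLe g e → DegLe (f *ₚ g) (d ℕ.+ e)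
  DegLe-*ₚ f g {d} degf degg n d+e<n = trans (coeff-*ₚ f g n) (conv-vanishes _ _ n split)
    where
    split : ∀ i → i ≤ n → coeff f i ≈ 0# ⊎ coeff g (n ∸ i) ≈ 0#
    split i _ with i ≤? d
    ... | yes i≤d = inj₂ (degg (n ∸ i) (d+e<n⇒e<n∸i i≤d d+e<n))
    ... | no  i≰d = inj₁ (degf i (ℕₚ.≰⇒> i≰d))

  DegLe-^ₚ : ∀ f {d} t → DegLe f d → DegLe (f ^ₚ t) (t ℕ.* d)
  DegLe-^ₚ f zero    degf (suc n) _ = refl
  DegLe-^ₚ f (suc t) degf           = DegLe-*ₚ f (f ^ₚ t) degf (DegLe-^ₚ f t degf)

  VanishesBelow-*ₚ : ∀ f g {m k} → VanishesBelow f m → VanishesBelow g k → VanishesBelow (f *ₚ g) (m ℕ.+ k)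
  VanishesBelow-*ₚ f g {m} f<m g<k n n<m+k = trans (coeff-*ₚ f g n) (conv-vanishes _ _ n split)
    where
    split : ∀ i → i ≤ n → coeff f i ≈ 0# ⊎ coeff g (n ∸ i) ≈ 0#
    split i i≤n with i <? m
    ... | yes i<m = inj₁ (f<m i i<m)
    ... | no  i≮m = inj₂ (g<k (n ∸ i) (n<m+k⇒n∸i<k (ℕₚ.≮⇒≥ i≮m) i≤n n<m+k))

  VanishesBelow-^ₚ : ∀ f {m} t → VanishesBelow f m → VanishesBelow (f ^ₚ t) (t ℕ.* m)
  VanishesBelow-^ₚ f zero    f<m i ()
  VanishesBelow-^ₚ f (suc t) f<m = VanishesBelow-*ₚ f (f ^ₚ t) f<m (VanishesBelow-^ₚ f t f<m)

  coeff-Xpow-*ₚ-< : ∀ l g {n} → n < l → coeff (Xpow l *ₚ g) n ≈ 0#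
  coeff-Xpow-*ₚ-< (suc l) g {zero}  _         = at (0∷-*ₚ (Xpow l) g) 0
  coeff-Xpow-*ₚ-< (suc l) g {suc n} (s≤s n<l) =
    trans (at (0∷-*ₚ (Xpow l) g) (suc n)) (coeff-Xpow-*ₚ-< l g n<l)

  coeff-Xpow-*ₚ-+ : ∀ l g k → coeff (Xpow l *ₚ g) (l ℕ.+ k) ≈ coeff g k
  coeff-Xpow-*ₚ-+ zero    g k = at (*ₚ-identityˡ g) k
  coeff-Xpow-*ₚ-+ (suc l) g k =
    trans (at (0∷-*ₚ (Xpow l) g) (suc (l ℕ.+ k))) (coeff-Xpow-*ₚ-+ l g k)

module EulerIdentities {c ℓ : Level} (R : CommutativeRing c ℓ) where
  open CommutativeRing R
  open Poly R
  open PolynomialArithmetic R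
  open PolynomialCoefficients R
  open import Algebra.Solver.Ring.NaturalCoefficients.Default commutativeSemiring
    using (solve; _:+_; _:=_)
  open import Relation.Binary.Reasoning.Setoid ≋-setoid

  euler-*ₚ : ∀ f g → euler (f *ₚ g) ≋ euler f *ₚ g +ₚ f *ₚ euler g
  euler-*ₚ []      g = ≋-refl
  euler-*ₚ (a ∷ f) g = begin
    euler (a ·ₚ g +ₚ (0# ∷ f *ₚ g))
      ≈⟨ euler-+ₚ (a ·ₚ g) (0# ∷ f *ₚ g) ⟩
    euler (a ·ₚ g) +ₚ euler (0# ∷ f *ₚ g)
      ≈⟨ +ₚ-cong (euler-·ₚ a g) (euler-∷ 0# (f *ₚ g)) ⟩
    a ·ₚ euler g +ₚ (0# ∷ euler (f *ₚ g) +ₚ f *ₚ g)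
      ≈⟨ +ₚ-cong ≋-refl (∷-cong refl (+ₚ-cong (euler-*ₚ f g) ≋-refl)) ⟩
    a ·ₚ euler g +ₚ (0# ∷ (euler f *ₚ g +ₚ f *ₚ euler g) +ₚ f *ₚ g)
      ≈⟨ regroup (a ·ₚ euler g) (euler f *ₚ g) (f *ₚ euler g) (f *ₚ g) ⟩
    (0# ∷ euler f *ₚ g +ₚ f *ₚ g) +ₚ (a ·ₚ euler g +ₚ (0# ∷ f *ₚ euler g))
      ≈⟨ +ₚ-cong (∷-cong {0#} refl (*ₚ-distribʳ-+ₚ (euler f) f g)) (≋-refl {(a ∷ f) *ₚ euler g}) ⟨
    (0# ∷ (euler f +ₚ f) *ₚ g) +ₚ (a ∷ f) *ₚ euler g
      ≈⟨ +ₚ-cong (0∷-*ₚ (euler f +ₚ f) g) ≋-refl ⟨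
    (0# ∷ euler f +ₚ f) *ₚ g +ₚ (a ∷ f) *ₚ euler g
      ≈⟨ +ₚ-cong (*ₚ-congʳ g (euler-∷ a f)) ≋-refl ⟨
    euler (a ∷ f) *ₚ g +ₚ (a ∷ f) *ₚ euler g
      ∎
    where
    shuffle : ∀ s x y z → s + ((x + y) + z) ≈ (x + z) + (s + y)
    shuffle = solve 4 (λ s x y z → s :+ ((x :+ y) :+ z) := (x :+ z) :+ (s :+ y)) refl
    regroup : ∀ s x y z → s +ₚ (0# ∷ (x +ₚ y) +ₚ z) ≋ (0# ∷ x +ₚ z) +ₚ (s +ₚ (0# ∷ y))
    regroup s x y z = coeffwise λ n →
      trans (coeff-+ₚ s (0# ∷ (x +ₚ y) +ₚ z) n)
      (trans (+-congˡ (trans (coeff-0∷-+ₚ (x +ₚ y) z n) (+-congʳ (coeff-0∷-+ₚ x y n))))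
      (trans (shuffle _ _ _ _)
      (sym (trans (coeff-+ₚ (0# ∷ x +ₚ z) (s +ₚ (0# ∷ y)) n)
                  (+-cong (coeff-0∷-+ₚ x z n) (coeff-+ₚ s (0# ∷ y) n))))))

  euler-^ₚ : ∀ f t → f *ₚ euler (f ^ₚ t) ≋ natCast t ·ₚ (euler f *ₚ f ^ₚ t)
  euler-^ₚ f zero = begin
    f *ₚ euler oneₚ          ≈⟨ *ₚ-congˡ f (coeffwise λ { zero → zeroˡ 1# ; (suc n) → refl }) ⟩
    f *ₚ []                  ≈⟨ *ₚ-zeroʳ f ⟩
    []                       ≈⟨ ·ₚ-zeroˡ (euler f *ₚ oneₚ) ⟨
    0# ·ₚ (euler f *ₚ oneₚ)  ∎
  euler-^ₚ f (suc t) = begin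
    f *ₚ euler (f *ₚ g)                       ≈⟨ *ₚ-congˡ f (euler-*ₚ f g) ⟩
    f *ₚ (euler f *ₚ g +ₚ f *ₚ euler g)       ≈⟨ *ₚ-distribˡ-+ₚ f (euler f *ₚ g) (f *ₚ euler g) ⟩
    h +ₚ f *ₚ (f *ₚ euler g)                  ≈⟨ +ₚ-cong ≋-refl (*ₚ-congˡ f (euler-^ₚ f t)) ⟩
    h +ₚ f *ₚ (natCast t ·ₚ (euler f *ₚ g))   ≈⟨ +ₚ-cong ≋-refl (*ₚ-·ₚ-comm f (natCast t) (euler f *ₚ g)) ⟩
    h +ₚ natCast t ·ₚ h                       ≈⟨ +ₚ-cong (·ₚ-identityˡ h) ≋-refl ⟨
    1# ·ₚ h +ₚ natCast t ·ₚ h                 ≈⟨ ·ₚ-distribʳ-+ 1# (natCast t) h ⟨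
    natCast (suc t) ·ₚ h                      ≈⟨ ·ₚ-congˡ (natCast (suc t)) (*ₚ-leftComm f (euler f) g) ⟩
    natCast (suc t) ·ₚ (euler f *ₚ (f *ₚ g))  ∎
    where
    g h : Pol
    g = f ^ₚ t
    h = f *ₚ (euler f *ₚ g)

module NatCast {c ℓ : Level} (R : CommutativeRing c ℓ) where
  open CommutativeRing R
  open Poly R
  open import Algebra.Properties.Semiring.Mult semiring using (_×_; ×-homo-+; ×1-homo-*)
  open import Relation.Binary.Reasoning.Setoid setoid

  natCast≡×1# : ∀ n → natCast n ≡ n × 1#
  natCast≡×1# zero    = ≡.refl
  natCast≡×1# (suc n) = ≡.cong (1# +_) (natCast≡×1# n)

  natCast-+ : ∀ m n → natCast (m ℕ.+ n) ≈ natCast m + natCast n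
  natCast-+ m n = begin
    natCast (m ℕ.+ n)      ≡⟨ natCast≡×1# (m ℕ.+ n) ⟩
    (m ℕ.+ n) × 1#         ≈⟨ ×-homo-+ 1# m n ⟩
    m × 1# + n × 1#        ≡⟨ ≡.cong₂ _+_ (natCast≡×1# m) (natCast≡×1# n) ⟨
    natCast m + natCast n  ∎

  natCast-* : ∀ m n → natCast (m ℕ.* n) ≈ natCast m * natCast n
  natCast-* m n = begin
    natCast (m ℕ.* n)      ≡⟨ natCast≡×1# (m ℕ.* n) ⟩
    (m ℕ.* n) × 1#         ≈⟨ ×1-homo-* m n ⟩
    m × 1# * n × 1#        ≡⟨ ≡.cong₂ _*_ (natCast≡×1# m) (natCast≡×1# n) ⟨
    natCast m * natCast n  ∎

module PowerCoefficients {c ℓ : Level} (R : CommutativeRing c ℓ) where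
  open CommutativeRing R
  open Poly R
  open PolynomialArithmetic R
  open PolynomialCoefficients R
  open EulerIdentities R using (euler-^ₚ)
  open NatCast R using (natCast-*)
  open import Algebra.Solver.Ring.NaturalCoefficients.Default commutativeSemiring
    using (solve; _:*_; _:=_)
  open import Relation.Binary.Reasoning.Setoid setoid

  -- The coefficients of X^(m+n) in euler-^ₚ: every term other than the one through f_m is killed
  -- by the degree bound or by the window hypothesis.
  coeff-^ₚ-recurrence :
    ∀ f t {m d} n → VanishesBelow f m → DegLe f d →
    (∀ i → 0 < i → i ≤ n → m ℕ.+ i ≤ d → coeff (f ^ₚ t) (n ∸ i) ≈ 0#) →
    natCast n * (coeff f m * coeff (f ^ₚ t) n) ≈ natCast (t ℕ.* m) * (coeff f m * coeff (f ^ₚ t) n)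
  coeff-^ₚ-recurrence f t {m} {d} n f<m degf window = begin
    natCast n * (coeff f m * coeff g n)              ≈⟨ x*[y*z]≈y*[x*z] _ _ _ ⟩
    coeff f m * (natCast n * coeff g n)              ≈⟨ *-congˡ (coeff-euler g n) ⟨
    coeff f m * coeff (euler g) n                    ≈⟨ coeff-*ₚ-lowest f (euler g) m n f<m f-or-θg ⟨
    coeff (f *ₚ euler g) (m ℕ.+ n)                   ≈⟨ at (euler-^ₚ f t) (m ℕ.+ n) ⟩
    coeff (natCast t ·ₚ (euler f *ₚ g)) (m ℕ.+ n)    ≈⟨ coeff-·ₚ (natCast t) (euler f *ₚ g) (m ℕ.+ n) ⟩
    natCast t * coeff (euler f *ₚ g) (m ℕ.+ n)       ≈⟨ *-congˡ (coeff-*ₚ-lowest (euler f) g m n θf<m θf-or-g) ⟩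
    natCast t * (coeff (euler f) m * coeff g n)      ≈⟨ *-congˡ (*-congʳ (coeff-euler f m)) ⟩
    natCast t * (natCast m * coeff f m * coeff g n)  ≈⟨ x*[y*z*w]≈x*y*[z*w] _ _ _ _ ⟩
    natCast t * natCast m * (coeff f m * coeff g n)  ≈⟨ *-congʳ (natCast-* t m) ⟨
    natCast (t ℕ.* m) * (coeff f m * coeff g n)      ∎
    where
    g : Pol
    g = f ^ₚ t
    θf<m : VanishesBelow (euler f) m
    θf<m i i<m = coeff-euler-vanishes f (f<m i i<m)
    f-or-θg : ∀ i → 0 < i → i ≤ n → coeff f (m ℕ.+ i) ≈ 0# ⊎ coeff (euler g) (n ∸ i) ≈ 0#
    f-or-θg i 0<i i≤n with m ℕ.+ i ≤? d
    ... | yes m+i≤d = inj₂ (coeff-euler-vanishes g (window i 0<i i≤n m+i≤d))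
    ... | no  m+i≰d = inj₁ (degf (m ℕ.+ i) (ℕₚ.≰⇒> m+i≰d))
    θf-or-g : ∀ i → 0 < i → i ≤ n → coeff (euler f) (m ℕ.+ i) ≈ 0# ⊎ coeff g (n ∸ i) ≈ 0#
    θf-or-g i 0<i i≤n with m ℕ.+ i ≤? d
    ... | yes m+i≤d = inj₂ (window i 0<i i≤n m+i≤d)
    ... | no  m+i≰d = inj₁ (coeff-euler-vanishes f (degf (m ℕ.+ i) (ℕₚ.≰⇒> m+i≰d)))
    x*[y*z]≈y*[x*z] : ∀ x y z → x * (y * z) ≈ y * (x * z)
    x*[y*z]≈y*[x*z] = solve 3 (λ x y z → x :* (y :* z) := y :* (x :* z)) refl
    x*[y*z*w]≈x*y*[z*w] : ∀ x y z w → x * (y * z * w) ≈ x * y * (z * w)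
    x*[y*z*w]≈x*y*[z*w] = solve 4 (λ x y z w → x :* (y :* z :* w) := x :* y :* (z :* w)) refl

module FieldOfCharacteristic {c ℓ : Level} (F : CommutativeRing c ℓ) (isField : IsField F) where
  open CommutativeRing F
  open Poly F
  open PolynomialCoefficients F using (VanishesBelow)
  open PowerCoefficients F using (coeff-^ₚ-recurrence)
  open NatCast F using (natCast-+)
  open import Algebra.Properties.Ring ring using (+-identityʳ-unique)
  open import Relation.Binary.Reasoning.Setoid setoid

  *-cancel-≉0 : ∀ {u x} → ¬ u ≈ 0# → u * x ≈ 0# → x ≈ 0#
  *-cancel-≉0 {u} {x} u≉0 ux≈0 with IsField.inverse isField u u≉0
  ... | v , uv≈1 = begin
    x            ≈⟨ *-identityˡ x ⟨
    1# * x       ≈⟨ *-congʳ uv≈1 ⟨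
    u * v * x    ≈⟨ *-congʳ (*-comm u v) ⟩
    v * u * x    ≈⟨ *-assoc v u x ⟩
    v * (u * x)  ≈⟨ *-congˡ ux≈0 ⟩
    v * 0#       ≈⟨ zeroʳ v ⟩
    0#           ∎

  module _ {p} (char : HasCharacteristic p) where

    natCast-*-cancel-< : ∀ {a b x} → a < b → b < p → natCast a * x ≈ natCast b * x → x ≈ 0#
    natCast-*-cancel-< {a} {b} {x} a<b b<p ax≈bx =
      *-cancel-≉0 (natCast[b∸a]≉0) (+-identityʳ-unique (natCast a * x) _ (sym ax≈ax+[b∸a]x))
      where
      natCast[b∸a]≉0 : ¬ natCast (b ∸ a) ≈ 0#
      natCast[b∸a]≉0 = proj₂ (proj₂ char) (b ∸ a) (ℕₚ.m<n⇒0<n∸m a<b) (ℕₚ.≤-<-trans (ℕₚ.m∸n≤m b a) b<p)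
      ax≈ax+[b∸a]x : natCast a * x ≈ natCast a * x + natCast (b ∸ a) * x
      ax≈ax+[b∸a]x = begin
        natCast a * x                        ≈⟨ ax≈bx ⟩
        natCast b * x                        ≡⟨ ≡.cong (λ k → natCast k * x) (ℕₚ.m+[n∸m]≡n (ℕₚ.<⇒≤ a<b)) ⟨
        natCast (a ℕ.+ (b ∸ a)) * x          ≈⟨ *-congʳ (natCast-+ a (b ∸ a)) ⟩
        (natCast a + natCast (b ∸ a)) * x    ≈⟨ distribʳ x _ _ ⟩
        natCast a * x + natCast (b ∸ a) * x  ∎

    natCast-*-cancel : ∀ {a b x} → a ≢ b → a < p → b < p → natCast a * x ≈ natCast b * x → x ≈ 0#
    natCast-*-cancel {a} {b} a≢b a<p b<p ax≈bx with ℕₚ.<-cmp a b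
    ... | tri< a<b _ _ = natCast-*-cancel-< a<b b<p ax≈bx
    ... | tri≈ _ a≡b _ = contradiction a≡b a≢b
    ... | tri> _ _ b<a = natCast-*-cancel-< b<a a<p (sym ax≈bx)

    coeff-^ₚ-vanishes :
      ∀ f t {m d} n → VanishesBelow f m → ¬ coeff f m ≈ 0# → DegLe f d →
      n ≢ t ℕ.* m → n < p → t ℕ.* m < p →
      (∀ i → 0 < i → i ≤ n → m ℕ.+ i ≤ d → coeff (f ^ₚ t) (n ∸ i) ≈ 0#) →
      coeff (f ^ₚ t) n ≈ 0#
    coeff-^ₚ-vanishes f t n f<m fm≉0 degf n≢tm n<p tm<p window =
      *-cancel-≉0 fm≉0 (natCast-*-cancel n≢tm n<p tm<p (coeff-^ₚ-recurrence f t n f<m degf window))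

module LargeGap {c ℓ : Level} (F : CommutativeRing c ℓ) (isField : IsField F)
                {p : ℕ} (char : Poly.HasCharacteristic F p) {t l d b : ℕ}
                (1≤t : 1 ≤ t) (td<p : t ℕ.* d < p) (b<p : b < p)
                (f A B : Poly.Pol F)
                (f^t≈AXˡ+B : Poly._≈ₚ_ F (Poly._^ₚ_ F f t) (Poly._+ₚ_ F (Poly._*ₚ_ F A (Poly.Xpow F l)) B))
                (degf : Poly.DegLe F f d) (degB : Poly.DegLe F B b)
                (A≉0 : Poly.NonZeroₚ F A) (B≉0 : Poly.NonZeroₚ F B)
                (d+b<l : d ℕ.+ b < l) where
  open CommutativeRing F
  open Poly F
  open PolynomialArithmetic F
  open PolynomialCoefficients F
  open FieldOfCharacteristic F isField using (coeff-^ₚ-vanishes)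
  open import Relation.Binary.Reasoning.Setoid setoid

  g : Pol
  g = f ^ₚ t

  b<l : b < l
  b<l = ℕₚ.≤-<-trans (ℕₚ.m≤n+m b d) d+b<l

  coeff-g-below-l : ∀ {j} → j < l → coeff g j ≈ coeff B j
  coeff-g-below-l {j} j<l = begin
    coeff g j                          ≈⟨ f^t≈AXˡ+B j ⟩
    coeff (A *ₚ Xpow l +ₚ B) j         ≈⟨ coeff-+ₚ (A *ₚ Xpow l) B j ⟩
    coeff (A *ₚ Xpow l) j + coeff B j  ≈⟨ +-congʳ (at (*ₚ-comm A (Xpow l)) j) ⟩
    coeff (Xpow l *ₚ A) j + coeff B j  ≈⟨ +-congʳ (coeff-Xpow-*ₚ-< l A j<l) ⟩
    0# + coeff B j                     ≈⟨ +-identityˡ _ ⟩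
    coeff B j                          ∎

  coeff-g-above-l : ∀ k → coeff g (l ℕ.+ k) ≈ coeff A k
  coeff-g-above-l k = begin
    coeff g (l ℕ.+ k)                                  ≈⟨ f^t≈AXˡ+B (l ℕ.+ k) ⟩
    coeff (A *ₚ Xpow l +ₚ B) (l ℕ.+ k)                 ≈⟨ coeff-+ₚ (A *ₚ Xpow l) B (l ℕ.+ k) ⟩
    coeff (A *ₚ Xpow l) (l ℕ.+ k) + coeff B (l ℕ.+ k)  ≈⟨ +-cong (at (*ₚ-comm A (Xpow l)) (l ℕ.+ k)) Bₗ₊ₖ≈0 ⟩
    coeff (Xpow l *ₚ A) (l ℕ.+ k) + 0#                 ≈⟨ +-identityʳ _ ⟩
    coeff (Xpow l *ₚ A) (l ℕ.+ k)                      ≈⟨ coeff-Xpow-*ₚ-+ l A k ⟩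
    coeff A k                                          ∎
    where
    Bₗ₊ₖ≈0 : coeff B (l ℕ.+ k) ≈ 0#
    Bₗ₊ₖ≈0 = degB (l ℕ.+ k) (ℕₚ.<-≤-trans b<l (ℕₚ.m≤m+n l k))

  B≋[] : (∀ j → j ≤ b → coeff g j ≈ 0#) → B ≋ []
  B≋[] g≤b≈0 = coeffwise Bⱼ≈0
    where
    Bⱼ≈0 : ∀ j → coeff B j ≈ 0#
    Bⱼ≈0 j with j ≤? b
    ... | yes j≤b = trans (sym (coeff-g-below-l (ℕₚ.≤-<-trans j≤b b<l))) (g≤b≈0 j j≤b)
    ... | no  j≰b = degB j (ℕₚ.≰⇒> j≰b)

  A≋[] : (∀ n → b < n → coeff g n ≈ 0#) → A ≋ []
  A≋[] g>b≈0 = coeffwise λ k →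
    trans (sym (coeff-g-above-l k)) (g>b≈0 (l ℕ.+ k) (ℕₚ.<-≤-trans b<l (ℕₚ.m≤m+n l k)))

  -- The recurrence carries the zeros of g on (b, l) upwards, as the window it looks back on
  -- has length at most d < l ∸ b.
  g-vanishes-above-b : ∀ {m} → VanishesBelow f m → ¬ coeff f m ≈ 0# → t ℕ.* m ≤ b →
                       ∀ n → b < n → coeff g n ≈ 0#
  g-vanishes-above-b {m} f<m fm≉0 tm≤b = <-rec (λ n → b < n → coeff g n ≈ 0#) step
    where
    step : ∀ n → (∀ {n′} → n′ < n → b < n′ → coeff g n′ ≈ 0#) → b < n → coeff g n ≈ 0#
    step n ih b<n with t ℕ.* d <? n | n <? l
    ... | yes td<n | _       = DegLe-^ₚ f t degf n td<n
    ... | no  _    | yes n<l = trans (coeff-g-below-l n<l) (degB n b<n)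
    ... | no  td≮n | no  n≮l =
      coeff-^ₚ-vanishes char f t n f<m fm≉0 degf
        (λ n≡tm → ℕₚ.<⇒≢ (ℕₚ.≤-<-trans tm≤b b<n) (≡.sym n≡tm))
        (ℕₚ.≤-<-trans (ℕₚ.≮⇒≥ td≮n) td<p)
        (ℕₚ.≤-<-trans tm≤b b<p)
        window
      where
      window : ∀ i → 0 < i → i ≤ n → m ℕ.+ i ≤ d → coeff g (n ∸ i) ≈ 0#
      window i 0<i i≤n m+i≤d =
        ih (ℕₚ.∸-monoʳ-< 0<i i≤n)
           (d+e<n⇒e<n∸i (ℕₚ.m+n≤o⇒n≤o m m+i≤d) (ℕₚ.<-≤-trans d+b<l (ℕₚ.≮⇒≥ n≮l)))

  -- f_m ≉ 0 is obtained from the recursive call at m + 1, so ≈ 0# never has to be decided;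
  -- k bounds the recursion, since tm ≤ b forces m ≤ b.
  ¬VanishesBelow : ∀ m k → b < m ℕ.+ k → ¬ VanishesBelow f m
  ¬VanishesBelow m k b<m+k f<m with t ℕ.* m ≤? b
  ... | no  tm≰b =
    NonZeroₚ⇒≉[] B≉0 (B≋[] λ j j≤b → VanishesBelow-^ₚ f t f<m j (ℕₚ.≤-<-trans j≤b (ℕₚ.≰⇒> tm≰b)))
  ... | yes tm≤b =
    NonZeroₚ⇒≉[] A≉0 (A≋[] (g-vanishes-above-b f<m (fm≉0 k b<m+k) tm≤b))
    where
    fm≉0 : ∀ k → b < m ℕ.+ k → ¬ coeff f m ≈ 0#
    fm≉0 zero    b<m+0  _    = ℕₚ.<⇒≱ b<m+0 (ℕₚ.≤-trans (ℕₚ.≤-reflexive (ℕₚ.+-identityʳ m)) m≤b)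
      where
      m≤b : m ≤ b
      m≤b = ℕₚ.≤-trans (ℕₚ.m≤n*m m t {{ℕ.>-nonZero 1≤t}}) tm≤b
    fm≉0 (suc k) b<m+1+k fm≈0 =
      ¬VanishesBelow (suc m) k (≡.subst (b <_) (ℕₚ.+-suc m k) b<m+1+k) (VanishesBelow-suc f f<m fm≈0)

open import Data.Nat using (_*_; _+_)

lemma4 : {c ℓ' : Level} (F : CommutativeRing c ℓ') → IsField F →
         (p : ℕ) → Poly.HasCharacteristic F p →
         (t ℓ d b : ℕ) → 1 ≤ t → t * d < p → b < p →
         (f A B : Poly.Pol F) →
         Poly._≈ₚ_ F (Poly._^ₚ_ F f t) (Poly._+ₚ_ F (Poly._*ₚ_ F A (Poly.Xpow F ℓ)) B) →
         Poly.DegLe F f d → Poly.DegLe F B b →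
         Poly.NonZeroₚ F A → Poly.NonZeroₚ F B →
         ℓ ≤ d + b
lemma4 F isField p char t l d b 1≤t td<p b<p f A B eq degf degB A≉0 B≉0 =
  ℕₚ.≮⇒≥ λ d+b<l →
    LargeGap.¬VanishesBelow F isField char 1≤t td<p b<p f A B eq degf degB A≉0 B≉0 d+b<l
      0 (suc b) (ℕₚ.n<1+n b) (λ _ ())
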